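{- Let $n,d,j$ be non-negative integers with $2\leq d\leq\sqrt{n/4}$ and $1\leq j\leq n/2$. Suppose that $$\frac{(2n-d)\tau(d,n)^2}{(n-2j)\tau(d,n)+n-j+1}\leq1\quad\text{and}\quad\tau_j(d,n)\geq0.$$ Then the sequence $(\tau_k(d,n))_{0\leq k\leq j}$ is strictly decreasing. In particular, if moreover $\tau_j(d,n)>\mu(d,n)$, then $\tau_k(d,n)>\mu(d,n)$ for every $k=0,\dots,j$.
   Context: For integers $n,d$ define $$\omega(d,n)=2n+\frac{n(4d^2-d-5)+8d^2-2d-15}{2n-8d^2+2d+15},\quad \tau(d,n)=\frac{(2n-d)(n-2d+3)}{\omega(d,n)\big(\omega(d,n)-n-d+3\big)},\quad \mu(d,n)=\frac{n}{(2n-d)\tau(d,n)}.$$ With $\tau=\tau(d,n)$, define $\tau_0(d,n)=\tau$ and, for $k=1,\dots,\lfloor n/2\rfloor$, $\tau_k(d,n)=\alpha_k\big(\tau_{k-1}(d,n)-\frac{2k-1}{2n-d}\big)$ with $\alpha_k=\frac{(2n-d)\tau^2}{(n-2k)\tau+n-k+1}$. -}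

module Defs where

open import Data.Nat as ℕ using (ℕ; zero; suc)
open import Data.Integer as ℤ using (ℤ; +_)
open import Data.Rational using (ℚ; _+_; _*_; _-_; 0ℚ; ≢-nonZero; _÷_) renaming (_/_ to _//_)
open import Data.Rational.Properties using (_≟_)
open import Relation.Nullary using (yes; no)

⟦_⟧ : ℕ → ℚ
⟦ n ⟧ = + n // 1

-- total division on ℚ; convention p / 0 = 0.  All denominators occurring
-- below are nonzero under the hypotheses of the lemma.
_/_ : ℚ → ℚ → ℚ
p / q with q ≟ 0ℚ
... | yes _ = 0ℚ
... | no q≢0 = _÷_ p q {{≢-nonZero q≢0}}
infixl 7 _/_

ω : ℕ → ℕ → ℚ
ω d n = ⟦ 2 ℕ.* n ⟧ + (⟦ n ⟧ * (⟦ 4 ℕ.* d ℕ.* d ⟧ - ⟦ d ⟧ - ⟦ 5 ⟧) + ⟦ 8 ℕ.* d ℕ.* d ⟧ - ⟦ 2 ℕ.* d ⟧ - ⟦ 15 ⟧)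
                    / (⟦ 2 ℕ.* n ⟧ - ⟦ 8 ℕ.* d ℕ.* d ⟧ + ⟦ 2 ℕ.* d ⟧ + ⟦ 15 ⟧)

τ : ℕ → ℕ → ℚ
τ d n = ((⟦ 2 ℕ.* n ⟧ - ⟦ d ⟧) * (⟦ n ⟧ - ⟦ 2 ℕ.* d ⟧ + ⟦ 3 ⟧))
        / (ω d n * (ω d n - ⟦ n ⟧ - ⟦ d ⟧ + ⟦ 3 ⟧))

μ : ℕ → ℕ → ℚ
μ d n = ⟦ n ⟧ / ((⟦ 2 ℕ.* n ⟧ - ⟦ d ⟧) * τ d n)

α : ℕ → ℕ → ℕ → ℚ
α d n k = ((⟦ 2 ℕ.* n ⟧ - ⟦ d ⟧) * (τ d n * τ d n))
          / ((⟦ n ⟧ - ⟦ 2 ℕ.* k ⟧) * τ d n + ⟦ n ⟧ - ⟦ k ⟧ + ⟦ 1 ⟧)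

τₖ : ℕ → ℕ → ℕ → ℚ
τₖ d n zero = τ d n
τₖ d n (suc k) = α d n (suc k) * (τₖ d n k - ⟦ 2 ℕ.* k ℕ.+ 1 ⟧ / (⟦ 2 ℕ.* n ⟧ - ⟦ d ⟧))

-- Only the denominators of the α_k depend on k, and they decrease in k, so
-- α_k ≤ α_j ≤ 1 for k ≤ j.  As α_{k+1} > 0, τ_{k+1} ≥ 0 forces
-- τ_k ≥ (2k+1)/(2n-d) > 0; hence nonnegativity propagates down from τ_j, and
-- then τ_{k+1} = α_{k+1} (τ_k - (2k+1)/(2n-d)) ≤ τ_k - (2k+1)/(2n-d) < τ_k.
-- Positivity of τ, needed for α_k > 0, follows from ω ≥ 2n; this is where
-- d ≥ 2 and n ≥ 4d² enter.
module Submission where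

open import Defs
open import Data.Nat as ℕ using (ℕ; suc; zero; z≤n; s≤s)
import Data.Nat.Properties as ℕP
open import Data.Nat.Tactic.RingSolver using (solve)
open import Data.Nat.Coprimality using (1-coprimeTo) renaming (sym to coprime-sym)
import Data.Integer as ℤ
import Data.Integer.Properties as ℤP
open import Data.Rational
  using (ℚ; _+_; _*_; _-_; -_; 1/_; _≤_; _<_; _>_; 0ℚ; 1ℚ; toℚᵘ; positive; nonNegative; ≢-nonZero)
open import Data.Rational.Properties
import Data.Rational.Unnormalised as ℚᵘ
import Data.Rational.Unnormalised.Properties as ℚᵘ
open import Data.List using (_∷_; [])
open import Data.Product using (_×_; _,_)
open import Data.Sum using (inj₁; inj₂)
open import Data.Empty using (⊥-elim)
open import Relation.Nullary using (yes; no)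
open import Relation.Binary.PropositionalEquality

private
  variable
    p q r : ℚ
    a b k : ℕ

toℚᵘ-⟦⟧ : ∀ n → toℚᵘ ⟦ n ⟧ ≡ ℚᵘ.mkℚᵘ (ℤ.+ n) 0
toℚᵘ-⟦⟧ n = cong toℚᵘ (normalize-coprime (coprime-sym (1-coprimeTo n)))

⟦⟧-+ : ∀ a b → ⟦ a ℕ.+ b ⟧ ≡ ⟦ a ⟧ + ⟦ b ⟧
⟦⟧-+ a b = toℚᵘ-injective (begin-equality
  toℚᵘ ⟦ a ℕ.+ b ⟧                            ≡⟨ toℚᵘ-⟦⟧ (a ℕ.+ b) ⟩
  ℚᵘ.mkℚᵘ (ℤ.+ (a ℕ.+ b)) 0                   ≃⟨ ℚᵘ.*≡* (cong (ℤ._* ℤ.+ 1) numerators) ⟩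
  ℚᵘ.mkℚᵘ (ℤ.+ a) 0 ℚᵘ.+ ℚᵘ.mkℚᵘ (ℤ.+ b) 0    ≡⟨ sym (cong₂ ℚᵘ._+_ (toℚᵘ-⟦⟧ a) (toℚᵘ-⟦⟧ b)) ⟩
  toℚᵘ ⟦ a ⟧ ℚᵘ.+ toℚᵘ ⟦ b ⟧                  ≃⟨ ℚᵘ.≃-sym (toℚᵘ-homo-+ ⟦ a ⟧ ⟦ b ⟧) ⟩
  toℚᵘ (⟦ a ⟧ + ⟦ b ⟧)                        ∎)
  where
  open ℚᵘ.≤-Reasoning
  numerators : ℤ.+ (a ℕ.+ b) ≡ ℤ.+ a ℤ.* ℤ.+ 1 ℤ.+ ℤ.+ b ℤ.* ℤ.+ 1
  numerators = trans (ℤP.pos-+ a b) (sym (cong₂ ℤ._+_ (ℤP.*-identityʳ (ℤ.+ a)) (ℤP.*-identityʳ (ℤ.+ b))))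

⟦⟧-mono-≤ : a ℕ.≤ b → ⟦ a ⟧ ≤ ⟦ b ⟧
⟦⟧-mono-≤ {a} {b} a≤b = toℚᵘ-cancel-≤ (subst₂ ℚᵘ._≤_ (sym (toℚᵘ-⟦⟧ a)) (sym (toℚᵘ-⟦⟧ b))
  (ℚᵘ.*≤* (ℤP.*-monoʳ-≤-nonNeg (ℤ.+ 1) (ℤ.+≤+ a≤b))))

⟦⟧-mono-< : a ℕ.< b → ⟦ a ⟧ < ⟦ b ⟧
⟦⟧-mono-< {a} {b} a<b = toℚᵘ-cancel-< (subst₂ ℚᵘ._<_ (sym (toℚᵘ-⟦⟧ a)) (sym (toℚᵘ-⟦⟧ b))
  (ℚᵘ.*<* (ℤP.*-monoʳ-<-pos (ℤ.+ 1) (ℤ.+<+ a<b))))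

-- ⟦_⟧ reduces (through normalize), so unification cannot recover a from ⟦ a ⟧:
-- such arguments are passed explicitly throughout.
⟦⟧-nonNeg : ∀ a → 0ℚ ≤ ⟦ a ⟧
⟦⟧-nonNeg a = ⟦⟧-mono-≤ {0} {a} z≤n

⟦⟧-pos : ∀ a → 0 ℕ.< a → 0ℚ < ⟦ a ⟧
⟦⟧-pos a = ⟦⟧-mono-< {0} {a}

⟦⟧-+-mono-≤ : ∀ a b {c} → a ℕ.+ b ℕ.≤ c → ⟦ a ⟧ + ⟦ b ⟧ ≤ ⟦ c ⟧
⟦⟧-+-mono-≤ a b le = subst (_≤ _) (⟦⟧-+ a b) (⟦⟧-mono-≤ le)

*-pos : 0ℚ < p → 0ℚ < q → 0ℚ < p * q
*-pos {p} {q} 0<p 0<q = positive⁻¹ _ {{pos*pos⇒pos p {{positive 0<p}} q {{positive 0<q}}}}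

*-nonNeg : 0ℚ ≤ p → 0ℚ ≤ q → 0ℚ ≤ p * q
*-nonNeg {p} {q} 0≤p 0≤q = nonNegative⁻¹ _ {{nonNeg*nonNeg⇒nonNeg p {{nonNegative 0≤p}} q {{nonNegative 0≤q}}}}

+-nonNeg : 0ℚ ≤ p → 0ℚ ≤ q → 0ℚ ≤ p + q
+-nonNeg {p} {q} 0≤p 0≤q = nonNegative⁻¹ _ {{nonNeg+nonNeg⇒nonNeg p {{nonNegative 0≤p}} q {{nonNegative 0≤q}}}}

+-nonNeg-pos : 0ℚ ≤ p → 0ℚ < q → 0ℚ < p + q
+-nonNeg-pos {p} {q} 0≤p 0<q = positive⁻¹ _ {{nonNeg+pos⇒pos p {{nonNegative 0≤p}} q {{positive 0<q}}}}

0≤p⇒q≤p+q : 0ℚ ≤ p → q ≤ p + q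
0≤p⇒q≤p+q {p} {q} 0≤p = subst (_≤ p + q) (+-identityˡ q) (+-monoˡ-≤ q 0≤p)

0≤p⇒q≤q+p : 0ℚ ≤ p → q ≤ q + p
0≤p⇒q≤q+p {p} {q} 0≤p = subst (_≤ q + p) (+-identityʳ q) (+-monoʳ-≤ q 0≤p)

0<q⇒p-q<p : 0ℚ < q → p - q < p
0<q⇒p-q<p {q} {p} 0<q = subst (p - q <_) (+-identityʳ p) (+-monoʳ-< p (neg-antimono-< 0<q))

p≤q⇒r-q≤r-p : ∀ r → p ≤ q → r - q ≤ r - p
p≤q⇒r-q≤r-p r p≤q = +-monoʳ-≤ r (neg-antimono-≤ p≤q)

p≤q⇒0≤q-p : p ≤ q → 0ℚ ≤ q - p
p≤q⇒0≤q-p {p} {q} p≤q = subst (_≤ q - p) (+-inverseʳ p) (+-monoˡ-≤ (- p) p≤q)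

p<q⇒0<q-p : p < q → 0ℚ < q - p
p<q⇒0<q-p {p} {q} p<q = subst (_< q - p) (+-inverseʳ p) (+-monoˡ-< (- p) p<q)

p+q≤r⇒0≤r-p-q : p + q ≤ r → 0ℚ ≤ r - p - q
p+q≤r⇒0≤r-p-q {p} {q} {r} p+q≤r = subst (0ℚ ≤_) r-[p+q]≡r-p-q (p≤q⇒0≤q-p p+q≤r)
  where
  r-[p+q]≡r-p-q : r - (p + q) ≡ r - p - q
  r-[p+q]≡r-p-q = trans (cong (r +_) (neg-distrib-+ p q)) (sym (+-assoc r (- p) (- q)))

p≤1⇒p*q≤q : p ≤ 1ℚ → 0ℚ ≤ q → p * q ≤ q
p≤1⇒p*q≤q {p} {q} p≤1 0≤q = subst (p * q ≤_) (*-identityˡ q) (*-monoʳ-≤-nonNeg q {{nonNegative 0≤q}} p≤1)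

0<p⇒0≤p*q⇒0≤q : 0ℚ < p → 0ℚ ≤ p * q → 0ℚ ≤ q
0<p⇒0≤p*q⇒0≤q {p} {q} 0<p 0≤pq =
  *-cancelˡ-≤-pos p {{positive 0<p}} (subst (_≤ p * q) (sym (*-zeroʳ p)) 0≤pq)

p/q*q≡p : ∀ p → 0ℚ < q → p / q * q ≡ p
p/q*q≡p {q} p 0<q with q ≟ 0ℚ
... | yes q≡0 = ⊥-elim (<-irrefl (sym q≡0) 0<q)
... | no q≢0 = begin
  p * 1/ q * q    ≡⟨ *-assoc p (1/ q) q ⟩
  p * (1/ q * q)  ≡⟨ cong (p *_) (*-inverseˡ q) ⟩
  p * 1ℚ          ≡⟨ *-identityʳ p ⟩
  p               ∎
  where
  open ≡-Reasoning
  instance _ = ≢-nonZero q≢0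

/-pos : 0ℚ < p → 0ℚ < q → 0ℚ < p / q
/-pos {p} {q} 0<p 0<q = *-cancelʳ-<-nonNeg q {{nonNegative (<⇒≤ 0<q)}}
  (subst₂ _<_ (sym (*-zeroˡ q)) (sym (p/q*q≡p p 0<q)) 0<p)

/-nonNeg : 0ℚ ≤ p → 0ℚ < q → 0ℚ ≤ p / q
/-nonNeg {p} {q} 0≤p 0<q = *-cancelʳ-≤-pos q {{positive 0<q}}
  (subst₂ _≤_ (sym (*-zeroˡ q)) (sym (p/q*q≡p p 0<q)) 0≤p)

/-antimonoʳ-≤ : 0ℚ ≤ p → 0ℚ < r → r ≤ q → p / q ≤ p / r
/-antimonoʳ-≤ {p} {r} {q} 0≤p 0<r r≤q = *-cancelʳ-≤-pos q {{positive 0<q}} (begin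
  p / q * q  ≡⟨ p/q*q≡p p 0<q ⟩
  p          ≡⟨ p/q*q≡p p 0<r ⟨
  p / r * r  ≤⟨ *-monoˡ-≤-nonNeg (p / r) {{nonNegative (/-nonNeg 0≤p 0<r)}} r≤q ⟩
  p / r * q  ∎)
  where
  open ≤-Reasoning
  0<q = <-≤-trans 0<r r≤q

downward-induction : ∀ {ℓ} (P : ℕ → Set ℓ) {j} →
                     (∀ {i} → i ℕ.< j → P (suc i) → P i) → P j → ∀ {k} → k ℕ.≤ j → P k
downward-induction P {j} step Pⱼ {k} k≤j = go j k≤j ℕP.≤-refl Pⱼ
  where
  go : ∀ i → k ℕ.≤ i → i ℕ.≤ j → P i → P k
  go zero z≤n _ P₀ = P₀
  go (suc i) k≤1+i 1+i≤j P₁₊ᵢ with ℕP.m≤n⇒m<n∨m≡n k≤1+i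
  ... | inj₂ refl = P₁₊ᵢ
  ... | inj₁ k<1+i = go i (ℕP.≤-pred k<1+i) (ℕP.<⇒≤ 1+i≤j) (step 1+i≤j P₁₊ᵢ)

module DampedRecurrence (x a c : ℕ → ℚ) {j : ℕ}
  (step : ∀ k → x (suc k) ≡ a (suc k) * (x k - c k))
  (a-pos : ∀ {k} → k ℕ.< j → 0ℚ < a (suc k))
  (a≤1 : ∀ {k} → k ℕ.< j → a (suc k) ≤ 1ℚ)
  (c-pos : ∀ k → 0ℚ < c k)
  (0≤xⱼ : 0ℚ ≤ x j)
  where

  0≤x-c : k ℕ.< j → 0ℚ ≤ x (suc k) → 0ℚ ≤ x k - c k
  0≤x-c {k} k<j 0≤x₁₊ₖ = 0<p⇒0≤p*q⇒0≤q (a-pos k<j) (subst (0ℚ ≤_) (step k) 0≤x₁₊ₖ)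

  nonNeg : k ℕ.≤ j → 0ℚ ≤ x k
  nonNeg = downward-induction (λ k → 0ℚ ≤ x k)
    (λ {k} k<j 0≤x₁₊ₖ → <⇒≤ (≤-<-trans (0≤x-c k<j 0≤x₁₊ₖ) (0<q⇒p-q<p (c-pos k)))) 0≤xⱼ

  decreasing : ∀ k → k ℕ.< j → x (suc k) < x k
  decreasing k k<j = ≤-<-trans x₁₊ₖ≤xₖ-cₖ (0<q⇒p-q<p (c-pos k))
    where
    x₁₊ₖ≤xₖ-cₖ : x (suc k) ≤ x k - c k
    x₁₊ₖ≤xₖ-cₖ = subst (_≤ x k - c k) (sym (step k)) (p≤1⇒p*q≤q (a≤1 k<j) (0≤x-c k<j (nonNeg k<j)))

  antitone : ∀ k → k ℕ.≤ j → x j ≤ x k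
  antitone k = downward-induction (λ k → x j ≤ x k)
    (λ {i} i<j xⱼ≤x₁₊ᵢ → ≤-trans xⱼ≤x₁₊ᵢ (<⇒≤ (decreasing i i<j))) ≤-refl

≤-by : ∀ {a b} c → a ℕ.+ c ≡ b → a ℕ.≤ b
≤-by {a} c refl = ℕP.m≤m+n a c

d<2n : ∀ {d n} → 2 ℕ.≤ d → 4 ℕ.* (d ℕ.* d) ℕ.≤ n → d ℕ.< 2 ℕ.* n
d<2n (s≤s (s≤s {n = e} z≤n)) 4d²≤n with m , refl ← ℕP.m≤n⇒∃[o]m+o≡n 4d²≤n =
  ≤-by (29 ℕ.+ 31 ℕ.* e ℕ.+ 8 ℕ.* (e ℕ.* e) ℕ.+ 2 ℕ.* m) (solve (e ∷ m ∷ []))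

2d≤n : ∀ {d n} → 2 ℕ.≤ d → 4 ℕ.* (d ℕ.* d) ℕ.≤ n → 2 ℕ.* d ℕ.≤ n
2d≤n {d} 2≤d 4d²≤n =
  ℕP.≤-trans (ℕP.*-monoˡ-≤ d 2≤d) (ℕP.≤-trans (ℕP.m≤m+n (d ℕ.* d) (3 ℕ.* (d ℕ.* d))) 4d²≤n)

n+d≤2n : ∀ {d n} → 2 ℕ.* d ℕ.≤ n → n ℕ.+ d ℕ.≤ 2 ℕ.* n
n+d≤2n {d} {n} 2d≤n = subst (n ℕ.+ d ℕ.≤_) n+n≡2n (ℕP.+-monoʳ-≤ n (ℕP.≤-trans (ℕP.m≤n*m d 2) 2d≤n))
  where
  n+n≡2n : n ℕ.+ n ≡ 2 ℕ.* n
  n+n≡2n = solve (n ∷ [])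

8d²≤2n : ∀ {d n} → 4 ℕ.* (d ℕ.* d) ℕ.≤ n → 8 ℕ.* d ℕ.* d ℕ.≤ 2 ℕ.* n
8d²≤2n {d} {n} 4d²≤n = subst (ℕ._≤ 2 ℕ.* n) 2[4d²]≡8d² (ℕP.*-monoʳ-≤ 2 4d²≤n)
  where
  2[4d²]≡8d² : 2 ℕ.* (4 ℕ.* (d ℕ.* d)) ≡ 8 ℕ.* d ℕ.* d
  2[4d²]≡8d² = solve (d ∷ [])

d+5≤4d² : ∀ {d} → 2 ℕ.≤ d → d ℕ.+ 5 ℕ.≤ 4 ℕ.* d ℕ.* d
d+5≤4d² (s≤s (s≤s {n = e} z≤n)) = ≤-by (9 ℕ.+ 15 ℕ.* e ℕ.+ 4 ℕ.* (e ℕ.* e)) (solve (e ∷ []))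

2d+15≤8d² : ∀ {d} → 2 ℕ.≤ d → 2 ℕ.* d ℕ.+ 15 ℕ.≤ 8 ℕ.* d ℕ.* d
2d+15≤8d² (s≤s (s≤s {n = e} z≤n)) = ≤-by (13 ℕ.+ 30 ℕ.* e ℕ.+ 8 ℕ.* (e ℕ.* e)) (solve (e ∷ []))

module _ {d n : ℕ} (2≤d : 2 ℕ.≤ d) (4d²≤n : 4 ℕ.* (d ℕ.* d) ℕ.≤ n) where

  2n-d-pos : 0ℚ < ⟦ 2 ℕ.* n ⟧ - ⟦ d ⟧
  2n-d-pos = p<q⇒0<q-p (⟦⟧-mono-< (d<2n 2≤d 4d²≤n))

  2n≤ω : ⟦ 2 ℕ.* n ⟧ ≤ ω d n
  2n≤ω = 0≤p⇒q≤q+p (/-nonNeg numerator-nonNeg denominator-pos)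
    where
    4d²-d-5-nonNeg : 0ℚ ≤ ⟦ 4 ℕ.* d ℕ.* d ⟧ - ⟦ d ⟧ - ⟦ 5 ⟧
    4d²-d-5-nonNeg = p+q≤r⇒0≤r-p-q (⟦⟧-+-mono-≤ d 5 (d+5≤4d² 2≤d))

    numerator-nonNeg : 0ℚ ≤ ⟦ n ⟧ * (⟦ 4 ℕ.* d ℕ.* d ⟧ - ⟦ d ⟧ - ⟦ 5 ⟧) + ⟦ 8 ℕ.* d ℕ.* d ⟧ - ⟦ 2 ℕ.* d ⟧ - ⟦ 15 ⟧
    numerator-nonNeg = p+q≤r⇒0≤r-p-q (≤-trans (⟦⟧-+-mono-≤ (2 ℕ.* d) 15 (2d+15≤8d² 2≤d))
                                               (0≤p⇒q≤p+q (*-nonNeg (⟦⟧-nonNeg n) 4d²-d-5-nonNeg)))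

    denominator-pos : 0ℚ < ⟦ 2 ℕ.* n ⟧ - ⟦ 8 ℕ.* d ℕ.* d ⟧ + ⟦ 2 ℕ.* d ⟧ + ⟦ 15 ⟧
    denominator-pos =
      +-nonNeg-pos (+-nonNeg (p≤q⇒0≤q-p (⟦⟧-mono-≤ (8d²≤2n {d} 4d²≤n))) (⟦⟧-nonNeg (2 ℕ.* d)))
                   (⟦⟧-pos 15 (s≤s z≤n))

  τ-pos : 0ℚ < τ d n
  τ-pos = /-pos (*-pos 2n-d-pos n-2d+3-pos) (*-pos ω-pos ω-n-d+3-pos)
    where
    n-2d+3-pos : 0ℚ < ⟦ n ⟧ - ⟦ 2 ℕ.* d ⟧ + ⟦ 3 ⟧
    n-2d+3-pos = +-nonNeg-pos (p≤q⇒0≤q-p (⟦⟧-mono-≤ (2d≤n 2≤d 4d²≤n))) (⟦⟧-pos 3 (s≤s z≤n))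

    ω-pos : 0ℚ < ω d n
    ω-pos = <-≤-trans (≤-<-trans (⟦⟧-nonNeg d) (⟦⟧-mono-< (d<2n 2≤d 4d²≤n))) 2n≤ω

    ω-n-d+3-pos : 0ℚ < ω d n - ⟦ n ⟧ - ⟦ d ⟧ + ⟦ 3 ⟧
    ω-n-d+3-pos =
      +-nonNeg-pos (p+q≤r⇒0≤r-p-q (≤-trans (⟦⟧-+-mono-≤ n d (n+d≤2n (2d≤n 2≤d 4d²≤n))) 2n≤ω))
                   (⟦⟧-pos 3 (s≤s z≤n))

α-den : ℕ → ℕ → ℕ → ℚ
α-den d n k = (⟦ n ⟧ - ⟦ 2 ℕ.* k ⟧) * τ d n + ⟦ n ⟧ - ⟦ k ⟧ + ⟦ 1 ⟧

module _ (d n : ℕ) (0<τ : 0ℚ < τ d n) (0<2n-d : 0ℚ < ⟦ 2 ℕ.* n ⟧ - ⟦ d ⟧) where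

  α-den-pos : ∀ k → 2 ℕ.* k ℕ.≤ n → 0ℚ < α-den d n k
  α-den-pos k 2k≤n = +-nonNeg-pos (p≤q⇒0≤q-p k≤[n-2k]τ+n) (⟦⟧-pos 1 (s≤s z≤n))
    where
    k≤[n-2k]τ+n : ⟦ k ⟧ ≤ (⟦ n ⟧ - ⟦ 2 ℕ.* k ⟧) * τ d n + ⟦ n ⟧
    k≤[n-2k]τ+n = ≤-trans (⟦⟧-mono-≤ (ℕP.≤-trans (ℕP.m≤n*m k 2) 2k≤n))
                          (0≤p⇒q≤p+q (*-nonNeg (p≤q⇒0≤q-p (⟦⟧-mono-≤ 2k≤n)) (<⇒≤ 0<τ)))

  α-den-antitone : ∀ {k j} → k ℕ.≤ j → α-den d n j ≤ α-den d n k
  α-den-antitone {k} {j} k≤j =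
    +-monoˡ-≤ ⟦ 1 ⟧ (+-mono-≤ (+-monoˡ-≤ ⟦ n ⟧ [n-2j]τ≤[n-2k]τ) (neg-antimono-≤ (⟦⟧-mono-≤ k≤j)))
    where
    [n-2j]τ≤[n-2k]τ : (⟦ n ⟧ - ⟦ 2 ℕ.* j ⟧) * τ d n ≤ (⟦ n ⟧ - ⟦ 2 ℕ.* k ⟧) * τ d n
    [n-2j]τ≤[n-2k]τ = *-monoʳ-≤-nonNeg (τ d n) {{nonNegative (<⇒≤ 0<τ)}}
                        (p≤q⇒r-q≤r-p ⟦ n ⟧ (⟦⟧-mono-≤ {2 ℕ.* k} {2 ℕ.* j} (ℕP.*-monoʳ-≤ 2 k≤j)))

  α-pos : ∀ k → 2 ℕ.* k ℕ.≤ n → 0ℚ < α d n k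
  α-pos k 2k≤n = /-pos (*-pos 0<2n-d (*-pos 0<τ 0<τ)) (α-den-pos k 2k≤n)

  α-mono-≤ : ∀ {k j} → 2 ℕ.* j ℕ.≤ n → k ℕ.≤ j → α d n k ≤ α d n j
  α-mono-≤ {j = j} 2j≤n k≤j =
    /-antimonoʳ-≤ (<⇒≤ (*-pos 0<2n-d (*-pos 0<τ 0<τ))) (α-den-pos j 2j≤n) (α-den-antitone k≤j)

lemma11p3 : (n d j : ℕ) → 2 ℕ.≤ d → 4 ℕ.* (d ℕ.* d) ℕ.≤ n → 1 ℕ.≤ j → 2 ℕ.* j ℕ.≤ n
    → α d n j ≤ 1ℚ → 0ℚ ≤ τₖ d n j
    → ((k : ℕ) → k ℕ.< j → τₖ d n (suc k) < τₖ d n k)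
      × (τₖ d n j > μ d n → (k : ℕ) → k ℕ.≤ j → τₖ d n k > μ d n)
lemma11p3 n d j 2≤d 4d²≤n _ 2j≤n αⱼ≤1 0≤τⱼ = decreasing , above-μ
  where
  0<τ : 0ℚ < τ d n
  0<τ = τ-pos 2≤d 4d²≤n

  0<2n-d : 0ℚ < ⟦ 2 ℕ.* n ⟧ - ⟦ d ⟧
  0<2n-d = 2n-d-pos 2≤d 4d²≤n

  offset : ℕ → ℚ
  offset k = ⟦ 2 ℕ.* k ℕ.+ 1 ⟧ / (⟦ 2 ℕ.* n ⟧ - ⟦ d ⟧)

  0<offset : ∀ k → 0ℚ < offset k
  0<offset k = /-pos (⟦⟧-pos (2 ℕ.* k ℕ.+ 1) (ℕP.m≤n+m 1 (2 ℕ.* k))) 0<2n-d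

  0<α₁₊ₖ : ∀ {k} → k ℕ.< j → 0ℚ < α d n (suc k)
  0<α₁₊ₖ {k} k<j = α-pos d n 0<τ 0<2n-d (suc k) (ℕP.≤-trans (ℕP.*-monoʳ-≤ 2 k<j) 2j≤n)

  α₁₊ₖ≤1 : ∀ {k} → k ℕ.< j → α d n (suc k) ≤ 1ℚ
  α₁₊ₖ≤1 k<j = ≤-trans (α-mono-≤ d n 0<τ 0<2n-d 2j≤n k<j) αⱼ≤1

  open DampedRecurrence (τₖ d n) (α d n) offset (λ _ → refl) 0<α₁₊ₖ α₁₊ₖ≤1 0<offset 0≤τⱼ

  above-μ : τₖ d n j > μ d n → ∀ k → k ℕ.≤ j → τₖ d n k > μ d n
  above-μ μ<τⱼ k k≤j = <-≤-trans μ<τⱼ (antitone k k≤j)
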